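{- Let $G$ be a graph. There exists a graph $G'$ on the same vertex set as $G$ with $E(G)\subseteq E(G')$ such that $\mathcal{R}_3(G')$ is a path and the largest diameter of a connected component of $\mathcal{R}_3(G)$ equals the largest diameter of a connected component of $\mathcal{R}_3(G')$.
   Context: All graphs are finite, simple and undirected. For a graph $G$, the $3$-configuration graph $\mathcal{R}_3(G)$ is the graph whose vertices are the independent sets of $G$ of size exactly $3$, where two such independent sets $I,J$ are adjacent if and only if $|I\cap J|=2$. -}

module Defs where

open import Data.Nat using (ℕ; zero; suc; _≤_; _<_)
open import Data.Fin using (Fin; toℕ)
open import Data.Fin.Subset using (Subset; _∈_; _∩_; ∣_∣)
open import Data.Bool using (Bool; true; false)
open import Data.Product using (Σ; ∃; _×_; ∃-syntax)
open import Data.Sum using (_⊎_)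
open import Relation.Binary.PropositionalEquality using (_≡_)
open import Relation.Nullary using (¬_)
open import Function.Bundles using (_⇔_)

record Graph (n : ℕ) : Set where
  field
    adj    : Fin n → Fin n → Bool
    sym    : ∀ x y → adj x y ≡ adj y x
    irrefl : ∀ x → adj x x ≡ false
open Graph public

_⊆E_ : ∀ {n} → Graph n → Graph n → Set
G ⊆E G' = ∀ x y → adj G x y ≡ true → adj G' x y ≡ true

Independent : ∀ {n} → Graph n → Subset n → Set
Independent G I = ∀ x y → x ∈ I → y ∈ I → adj G x y ≡ false

R3Vertex : ∀ {n} → Graph n → Subset n → Set
R3Vertex G I = ∣ I ∣ ≡ 3 × Independent G I

R3Adj : ∀ {n} → Subset n → Subset n → Set
R3Adj I J = ∣ I ∩ J ∣ ≡ 2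

data R3Walk {n} (G : Graph n) : Subset n → Subset n → ℕ → Set where
  stay : ∀ {I} → R3Vertex G I → R3Walk G I I zero
  step : ∀ {I J K k} → R3Vertex G I → R3Adj I J → R3Walk G J K k →
         R3Walk G I K (suc k)

R3Dist : ∀ {n} → Graph n → Subset n → Subset n → ℕ → Set
R3Dist G I J d = R3Walk G I J d × (∀ k → k < d → ¬ R3Walk G I J k)

-- D is the largest diameter of a connected component of R₃(G), i.e. the
-- maximum distance between two vertices lying in a common component.
LargestCompDiam : ∀ {n} → Graph n → ℕ → Set
LargestCompDiam G D =
  (∃[ I ] ∃[ J ] R3Dist G I J D) × (∀ I J d → R3Dist G I J d → d ≤ D)

R3IsPath : ∀ {n} → Graph n → Set
R3IsPath {n} G = ∃[ m ] Σ (Fin (suc m) → Subset n) λ f →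
  (∀ i → R3Vertex G (f i)) ×
  (∀ i j → f i ≡ f j → i ≡ j) ×
  (∀ I → R3Vertex G I → ∃[ i ] f i ≡ I) ×
  (∀ i j → R3Adj (f i) (f j) ⇔ (toℕ i ≡ suc (toℕ j) ⊎ toℕ j ≡ suc (toℕ i)))

{-# OPTIONS --safe #-}
module Submission where

-- Take a longest geodesic f 0, …, f D of R₃(G); it exists because distances are bounded by the
-- number 2ⁿ of subsets. Let G′ join x ≠ y exactly when no f i contains both, so that G ⊆ G′ and
-- every f i stays independent. Each pair of an independent triple T of G′ lies in some f i. If no
-- f i contains all of T, three of them are R₃-neighbours of T, hence pairwise at most two apart on
-- the geodesic, hence consecutive; then either the middle one has four elements or the outer two
-- share two and are R₃-adjacent. So R₃(G′) is exactly the path f 0, …, f D, whose diameter is D.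

open import Defs hiding (sym)

open import Data.Bool using (true; false; not)
import Data.Bool.Properties as Bool
open import Data.Empty using (⊥; ⊥-elim)
open import Data.Fin using (Fin; zero; suc; toℕ; fromℕ; _≟_)
open import Data.Fin.Base using (funToFin; finToFun)
import Data.Fin.Properties as Fin
open import Data.Fin.Properties
  using (toℕ-injective; toℕ-fromℕ; toℕ≤pred[n]; any?; all?; pigeonhole; 2↔Bool; finToFun-funToFin)
open import Data.Fin.Subset using (Subset; _∈_; _∉_; _⊆_; _∩_; _-_; ∣_∣; Nonempty; inside; outside)
open import Data.Fin.Subset.Properties
  using (_∈?_; anySubset?; nonempty?; Empty-unique; ∣⊥∣≡0; p─⊥≡p; p─q⊆p; x∈p∧x≢y⇒x∈p-y;
         drop-∷-⊆; p⊆q⇒∣p∣≤∣q∣; x∈p∩q⁺; x∈p∩q⁻; p∩q⊆p; p∩q⊆q; ∣p∩q∣≤∣p∣; ∩-comm; ∩-idem)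
open import Data.List using ([]; _∷_; length)
open import Data.List.Relation.Unary.All as All using (All; []; _∷_)
open import Data.List.Relation.Unary.AllPairs using ([]; _∷_)
open import Data.List.Relation.Unary.Unique.Propositional using (Unique)
import Data.Nat as ℕ
open import Data.Nat using (ℕ; zero; suc; _+_; _^_; _≤_; _<_; z≤n; s≤s)
open import Data.Nat.Properties
  using (suc-injective; 0≢1+n; ≤-antisym; ≤-reflexive; ≤-trans; ≤-total; ≤-pred; <-irrefl; <-cmp;
         <⇒≢; <⇒≱; ≮⇒≥; ≰⇒>; ≤∧≢⇒<; m≤n⇒m<n∨m≡n; m≤n+m; +-identityʳ; +-assoc; +-comm; +-cancelʳ-≤;
         allUpTo?; module ≤-Reasoning)
open import Data.Product as Product using (∃; ∃-syntax; _×_; _,_; proj₁; proj₂)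
open import Data.Sum as Sum using (_⊎_; inj₁; inj₂; [_,_])
open import Data.Vec using ([]; _∷_; lookup; tabulate)
open import Data.Vec.Base using (here; there)
open import Data.Vec.Properties using (≡-dec; tabulate∘lookup; tabulate-cong)
open import Function using (_∘_)
open import Function.Bundles using (_⇔_; mk⇔; Equivalence; Inverse)
open import Relation.Binary.Definitions using (tri<; tri≈; tri>)
open import Relation.Binary.PropositionalEquality hiding ([_])
open import Relation.Nullary using (¬_; Dec; yes; no; contradiction)
open import Relation.Nullary.Decidable
  using (does; dec-true; dec-false; does-⇔; decidable-stable; map′; ¬?; _×-dec_; _⊎-dec_; _→-dec_)

private
  variable
    n : ℕ
    p q : Subset n
    x y : Fin n

∣p∣≡1+∣p-x∣ : x ∈ p → ∣ p ∣ ≡ suc ∣ p - x ∣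
∣p∣≡1+∣p-x∣ {x = zero} {inside ∷ p} _ = cong (λ q → suc ∣ q ∣) (sym (p─⊥≡p p))
∣p∣≡1+∣p-x∣ {p = inside ∷ p} (there x∈p) = cong suc (∣p∣≡1+∣p-x∣ x∈p)
∣p∣≡1+∣p-x∣ {p = outside ∷ p} (there x∈p) = ∣p∣≡1+∣p-x∣ x∈p

x∉p-x : x ∉ p - x
x∉p-x {x = suc x} {_ ∷ p} (there x∈p-x) = x∉p-x x∈p-x

x∈p-y⁻ : x ∈ p - y → x ∈ p × x ≢ y
x∈p-y⁻ {p = p} x∈p-y = p─q⊆p p _ x∈p-y , λ { refl → x∉p-x x∈p-y }

∣p∣≡1+k⇒∣p-x∣≡k : ∀ {k} → x ∈ p → ∣ p ∣ ≡ suc k → ∣ p - x ∣ ≡ k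
∣p∣≡1+k⇒∣p-x∣≡k x∈p ∣p∣≡1+k = suc-injective (trans (sym (∣p∣≡1+∣p-x∣ x∈p)) ∣p∣≡1+k)

∣p∣≡1+k⇒Nonempty : ∀ {k} → ∣ p ∣ ≡ suc k → Nonempty p
∣p∣≡1+k⇒Nonempty {n} {p} ∣p∣≡1+k = decidable-stable (nonempty? p) λ p-empty →
  0≢1+n (trans (sym (trans (cong ∣_∣ (Empty-unique p-empty)) (∣⊥∣≡0 n))) ∣p∣≡1+k)

∣p∣≡2+k⇒∃≢ : ∀ {k} → ∣ p ∣ ≡ 2 + k → y ∈ p → ∃[ x ] x ∈ p × x ≢ y
∣p∣≡2+k⇒∃≢ ∣p∣≡2+k y∈p with x , x∈p-y ← ∣p∣≡1+k⇒Nonempty (∣p∣≡1+k⇒∣p-x∣≡k y∈p ∣p∣≡2+k) =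
  x , x∈p-y⁻ x∈p-y

unique-length≤∣p∣ : ∀ {xs} → Unique xs → All (_∈ p) xs → length xs ≤ ∣ p ∣
unique-length≤∣p∣ [] [] = z≤n
unique-length≤∣p∣ {p = p} {x ∷ xs} (x≢xs ∷ xs!) (x∈p ∷ xs⊆p) =
  subst (_ ≤_) (sym (∣p∣≡1+∣p-x∣ x∈p)) (s≤s (unique-length≤∣p∣ xs! xs⊆p-x))
  where
  xs⊆p-x : All (_∈ p - x) xs
  xs⊆p-x = All.zipWith (λ (x≢y , y∈p) → x∈p∧x≢y⇒x∈p-y y∈p (≢-sym x≢y)) (x≢xs , xs⊆p)

p⊆q∧∣p∣≡∣q∣⇒p≡q : p ⊆ q → ∣ p ∣ ≡ ∣ q ∣ → p ≡ q
p⊆q∧∣p∣≡∣q∣⇒p≡q {p = []} {[]} _ _ = refl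
p⊆q∧∣p∣≡∣q∣⇒p≡q {p = inside ∷ p} {inside ∷ q} p⊆q eq =
  cong (inside ∷_) (p⊆q∧∣p∣≡∣q∣⇒p≡q (drop-∷-⊆ p⊆q) (suc-injective eq))
p⊆q∧∣p∣≡∣q∣⇒p≡q {p = outside ∷ p} {outside ∷ q} p⊆q eq =
  cong (outside ∷_) (p⊆q∧∣p∣≡∣q∣⇒p≡q (drop-∷-⊆ p⊆q) eq)
p⊆q∧∣p∣≡∣q∣⇒p≡q {p = inside ∷ p} {outside ∷ q} p⊆q _ with () ← p⊆q here
p⊆q∧∣p∣≡∣q∣⇒p≡q {p = outside ∷ p} {inside ∷ q} p⊆q eq =
  contradiction eq (<⇒≢ (s≤s (p⊆q⇒∣p∣≤∣q∣ (drop-∷-⊆ p⊆q))))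

∣p∩q∣≡∣p∣∧∣p∩q∣≡∣q∣⇒p≡q : ∣ p ∩ q ∣ ≡ ∣ p ∣ → ∣ p ∩ q ∣ ≡ ∣ q ∣ → p ≡ q
∣p∩q∣≡∣p∣∧∣p∩q∣≡∣q∣⇒p≡q {p = p} {q} ∣p∩q∣≡∣p∣ ∣p∩q∣≡∣q∣ =
  trans (sym (p⊆q∧∣p∣≡∣q∣⇒p≡q (p∩q⊆p p q) ∣p∩q∣≡∣p∣)) (p⊆q∧∣p∣≡∣q∣⇒p≡q (p∩q⊆q p q) ∣p∩q∣≡∣q∣)

3-sets-≡ : ∣ p ∣ ≡ 3 → ∣ q ∣ ≡ 3 → 3 ≤ ∣ p ∩ q ∣ → p ≡ q
3-sets-≡ {p = p} {q} ∣p∣≡3 ∣q∣≡3 3≤∣p∩q∣ =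
  ∣p∩q∣≡∣p∣∧∣p∩q∣≡∣q∣⇒p≡q (trans ∣p∩q∣≡3 (sym ∣p∣≡3)) (trans ∣p∩q∣≡3 (sym ∣q∣≡3))
  where
  ∣p∩q∣≡3 : ∣ p ∩ q ∣ ≡ 3
  ∣p∩q∣≡3 = ≤-antisym (subst (∣ p ∩ q ∣ ≤_) ∣p∣≡3 (∣p∩q∣≤∣p∣ p q)) 3≤∣p∩q∣

3-sets-R3Adj : ∣ p ∣ ≡ 3 → ∣ q ∣ ≡ 3 → 2 ≤ ∣ p ∩ q ∣ → p ≢ q → R3Adj p q
3-sets-R3Adj {p = p} {q} ∣p∣≡3 ∣q∣≡3 2≤∣p∩q∣ p≢q
  with m≤n⇒m<n∨m≡n (subst (∣ p ∩ q ∣ ≤_) ∣p∣≡3 (∣p∩q∣≤∣p∣ p q))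
... | inj₁ ∣p∩q∣<3 = ≤-antisym (≤-pred ∣p∩q∣<3) 2≤∣p∩q∣
... | inj₂ ∣p∩q∣≡3 = contradiction (3-sets-≡ ∣p∣≡3 ∣q∣≡3 (≤-reflexive (sym ∣p∩q∣≡3))) p≢q

R3Adj-sym : R3Adj p q → R3Adj q p
R3Adj-sym {p = p} {q} = trans (cong ∣_∣ (∩-comm q p))

R3Adj-irrefl : ∣ p ∣ ≡ 3 → ¬ R3Adj p p
R3Adj-irrefl {p = p} ∣p∣≡3 p~p with () ← trans (sym p~p) (trans (cong ∣_∣ (∩-idem p)) ∣p∣≡3)

∃-three-elements : ∣ p ∣ ≡ 3 → ∃[ a ] ∃[ b ] ∃[ c ] (a ∈ p × b ∈ p × c ∈ p × a ≢ b × a ≢ c × b ≢ c)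
∃-three-elements ∣p∣≡3
  with a , a∈p ← ∣p∣≡1+k⇒Nonempty ∣p∣≡3
  with b , b∈p , b≢a ← ∣p∣≡2+k⇒∃≢ ∣p∣≡3 a∈p
  with c , c∈p-a , c≢b ← ∣p∣≡2+k⇒∃≢ (∣p∣≡1+k⇒∣p-x∣≡k a∈p ∣p∣≡3) (x∈p∧x≢y⇒x∈p-y b∈p b≢a)
  with c∈p , c≢a ← x∈p-y⁻ c∈p-a
  = a , b , c , a∈p , b∈p , c∈p , ≢-sym b≢a , ≢-sym c≢a , ≢-sym c≢b

∈∉⇒≢ : x ∈ p → y ∉ p → x ≢ y
∈∉⇒≢ x∈p y∉p refl = y∉p x∈p

-- The second elements of A ∩ B and of B ∩ C coincide, else B has four elements; with x they make
-- A and C adjacent.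
chain-triangle-impossible : ∀ {A B C : Subset n} {x y z} →
  ∣ A ∣ ≡ 3 → ∣ B ∣ ≡ 3 → ∣ C ∣ ≡ 3 → R3Adj A B → R3Adj B C → ¬ R3Adj A C → A ≢ C →
  x ∈ A → x ∈ C → x ∉ B → y ∈ A → y ∈ B → y ∉ C → z ∈ B → z ∈ C → z ∉ A → ⊥
chain-triangle-impossible {A = A} {B} {C} {x} {y} {z} ∣A∣≡3 ∣B∣≡3 ∣C∣≡3 A~B B~C A≁C A≢C
  x∈A x∈C x∉B y∈A y∈B y∉C z∈B z∈C z∉A
  with u , u∈A∩B , u≢y ← ∣p∣≡2+k⇒∃≢ A~B (x∈p∩q⁺ (y∈A , y∈B))
  with v , v∈B∩C , v≢z ← ∣p∣≡2+k⇒∃≢ B~C (x∈p∩q⁺ (z∈B , z∈C))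
  with u∈A , u∈B ← x∈p∩q⁻ A B u∈A∩B
  with v∈B , v∈C ← x∈p∩q⁻ B C v∈B∩C
  with u ≟ v
... | no u≢v = <-irrefl refl
  (subst (4 ≤_) ∣B∣≡3 (unique-length≤∣p∣ y-z-u-v-distinct (y∈B ∷ z∈B ∷ u∈B ∷ v∈B ∷ [])))
  where
  y-z-u-v-distinct : Unique (y ∷ z ∷ u ∷ v ∷ [])
  y-z-u-v-distinct =
    (≢-sym (∈∉⇒≢ z∈C y∉C) ∷ ≢-sym u≢y ∷ ≢-sym (∈∉⇒≢ v∈C y∉C) ∷ []) ∷
    (≢-sym (∈∉⇒≢ u∈A z∉A) ∷ ≢-sym v≢z ∷ []) ∷
    (u≢v ∷ []) ∷ [] ∷ []
... | yes refl = A≁C (3-sets-R3Adj ∣A∣≡3 ∣C∣≡3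
  (unique-length≤∣p∣ ((∈∉⇒≢ u∈B x∉B ∘ sym ∷ []) ∷ [] ∷ [])
                     (x∈p∩q⁺ (x∈A , x∈C) ∷ x∈p∩q⁺ (u∈A , v∈C) ∷ []))
  A≢C)

infix 4 _∼_
_∼_ : ℕ → ℕ → Set
m ∼ n = m ≡ suc n ⊎ n ≡ suc m

∼-sym : ∀ {a b} → a ∼ b → b ∼ a
∼-sym = Sum.swap

∼-not-transitive : ∀ {a b c} → a ∼ b → b ∼ c → ¬ a ∼ c
∼-not-transitive (inj₁ refl) (inj₁ refl) (inj₁ ())
∼-not-transitive (inj₁ refl) (inj₁ refl) (inj₂ ())
∼-not-transitive (inj₁ refl) (inj₂ refl) (inj₁ ())
∼-not-transitive (inj₁ refl) (inj₂ refl) (inj₂ ())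
∼-not-transitive (inj₂ refl) (inj₁ refl) (inj₁ ())
∼-not-transitive (inj₂ refl) (inj₁ refl) (inj₂ ())
∼-not-transitive (inj₂ refl) (inj₂ refl) (inj₁ ())
∼-not-transitive (inj₂ refl) (inj₂ refl) (inj₂ ())

≢∧≤1+⇒∼ : ∀ {a b} → a ≢ b → b ≤ 1 + a → a ≤ 1 + b → a ∼ b
≢∧≤1+⇒∼ {a} {b} a≢b b≤1+a a≤1+b with <-cmp a b
... | tri< a<b _ _ = inj₂ (≤-antisym b≤1+a a<b)
... | tri≈ _ a≡b _ = contradiction a≡b a≢b
... | tri> _ _ b<a = inj₁ (≤-antisym a≤1+b b<a)

WithinTwo : ℕ → ℕ → Set
WithinTwo a b = a ≤ 2 + b × b ≤ 2 + a

<∧<∧≤2+⇒∼ : ∀ {a b c} → a < b → b < c → c ≤ 2 + a → a ∼ b × b ∼ c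
<∧<∧≤2+⇒∼ a<b b<c c≤2+a = inj₂ b≡1+a , inj₂ (trans c≡2+a (cong suc (sym b≡1+a)))
  where
  c≡2+a : _ ≡ 2 + _
  c≡2+a = ≤-antisym c≤2+a (≤-trans (s≤s a<b) b<c)
  b≡1+a : _ ≡ 1 + _
  b≡1+a = ≤-antisym (≤-pred (subst (_ <_) c≡2+a b<c)) a<b

middle-of-three : ∀ {P Q R} → P ≢ Q → Q ≢ R → P ≢ R →
  WithinTwo P Q → WithinTwo Q R → WithinTwo P R →
  (P ∼ Q × Q ∼ R) ⊎ (Q ∼ P × P ∼ R) ⊎ (P ∼ R × R ∼ Q)
middle-of-three {P} {Q} {R} P≢Q Q≢R P≢R (P≤2+Q , Q≤2+P) (Q≤2+R , R≤2+Q) (P≤2+R , R≤2+P)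
  with <-cmp P Q
... | tri≈ _ P≡Q _ = contradiction P≡Q P≢Q
... | tri< P<Q _ _ with <-cmp Q R
...   | tri≈ _ Q≡R _ = contradiction Q≡R Q≢R
...   | tri< Q<R _ _ = inj₁ (<∧<∧≤2+⇒∼ P<Q Q<R R≤2+P)
...   | tri> _ _ R<Q with <-cmp P R
...     | tri≈ _ P≡R _ = contradiction P≡R P≢R
...     | tri< P<R _ _ = inj₂ (inj₂ (<∧<∧≤2+⇒∼ P<R R<Q Q≤2+P))
...     | tri> _ _ R<P =
  let R∼P , P∼Q = <∧<∧≤2+⇒∼ R<P P<Q Q≤2+R in inj₂ (inj₁ (∼-sym P∼Q , ∼-sym R∼P))
middle-of-three {P} {Q} {R} P≢Q Q≢R P≢R (P≤2+Q , Q≤2+P) (Q≤2+R , R≤2+Q) (P≤2+R , R≤2+P)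
    | tri> _ _ Q<P with <-cmp P R
...   | tri≈ _ P≡R _ = contradiction P≡R P≢R
...   | tri< P<R _ _ = inj₂ (inj₁ (<∧<∧≤2+⇒∼ Q<P P<R R≤2+Q))
...   | tri> _ _ R<P with <-cmp Q R
...     | tri≈ _ Q≡R _ = contradiction Q≡R Q≢R
...     | tri< Q<R _ _ =
  let Q∼R , R∼P = <∧<∧≤2+⇒∼ Q<R R<P P≤2+Q in inj₂ (inj₂ (∼-sym R∼P , ∼-sym Q∼R))
...     | tri> _ _ R<Q =
  let R∼Q , Q∼P = <∧<∧≤2+⇒∼ R<Q Q<P P≤2+R in inj₁ (∼-sym Q∼P , ∼-sym R∼Q)

module _ {G : Graph n} where

  source-vertex : ∀ {I K k} → R3Walk G I K k → R3Vertex G I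
  source-vertex (stay v) = v
  source-vertex (step v _ _) = v

  target-vertex : ∀ {I K k} → R3Walk G I K k → R3Vertex G K
  target-vertex (stay v) = v
  target-vertex (step _ _ w) = target-vertex w

  _++ʷ_ : ∀ {I J K a b} → R3Walk G I J a → R3Walk G J K b → R3Walk G I K (a + b)
  stay _ ++ʷ w′ = w′
  step v I~J w ++ʷ w′ = step v I~J (w ++ʷ w′)

  snoc : ∀ {I J K k} → R3Walk G I J k → R3Adj J K → R3Vertex G K → R3Walk G I K (suc k)
  snoc (stay v) J~K vK = step v J~K (stay vK)
  snoc (step v I~J w) J~K vK = step v I~J (snoc w J~K vK)

  reverse : ∀ {I J k} → R3Walk G I J k → R3Walk G J I k
  reverse (stay v) = stay v
  reverse (step {I} {J} v I~J w) = snoc (reverse w) (R3Adj-sym {p = I} {J} I~J) v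

  at : ∀ {I K k} → R3Walk G I K k → Fin (suc k) → Subset n
  at {I} _ zero = I
  at (step _ _ w) (suc i) = at w i

  at-vertex : ∀ {I K k} (w : R3Walk G I K k) i → R3Vertex G (at w i)
  at-vertex w zero = source-vertex w
  at-vertex (step _ _ w) (suc i) = at-vertex w i

  at-R3Adj : ∀ {I K k} (w : R3Walk G I K k) {i j} → toℕ j ≡ suc (toℕ i) → R3Adj (at w i) (at w j)
  at-R3Adj (step _ I~J _) {zero} {suc zero} _ = I~J
  at-R3Adj (step _ _ w) {suc i} {suc j} j≡1+i = at-R3Adj w (suc-injective j≡1+i)

  suffix : ∀ {I K k} (w : R3Walk G I K k) i → ∃[ m ] R3Walk G (at w i) K m × toℕ i + m ≡ k
  suffix w zero = _ , w , refl
  suffix (step _ _ w) (suc i) with m , w′ , i+m≡k ← suffix w i = m , w′ , cong suc i+m≡k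

  prefix : ∀ {H I K k} (w : R3Walk G I K k) → (∀ i → R3Vertex H (at w i)) →
           ∀ i → R3Walk H I (at w i) (toℕ i)
  prefix w on-H zero = stay (on-H zero)
  prefix (step _ I~J w) on-H (suc i) = step (on-H zero) I~J (prefix w (on-H ∘ suc) i)

  segment : ∀ {H I K k} (w : R3Walk G I K k) → (∀ i → R3Vertex H (at w i)) →
            ∀ i j → toℕ i ≤ toℕ j → ∃[ l ] R3Walk H (at w i) (at w j) l × toℕ i + l ≡ toℕ j
  segment w on-H zero j _ = toℕ j , prefix w on-H j , refl
  segment (step _ _ w) on-H (suc i) (suc j) (s≤s i≤j)
    with l , w′ , i+l≡j ← segment w (on-H ∘ suc) i j i≤j = l , w′ , cong suc i+l≡j

R3Dist-minimal : ∀ {G : Graph n} {I J d l} → R3Dist G I J d → R3Walk G I J l → d ≤ l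
R3Dist-minimal (_ , minimal) c = ≮⇒≥ λ l<d → minimal _ l<d c

map-R3Walk : ∀ {G H : Graph n} → (∀ {I} → R3Vertex G I → R3Vertex H I) →
             ∀ {I J k} → R3Walk G I J k → R3Walk H I J k
map-R3Walk f (stay v) = stay (f v)
map-R3Walk f (step v I~J w) = step (f v) I~J (map-R3Walk f w)

module Geodesic {G : Graph n} {I K k} (w : R3Walk G I K k)
                (minimal : ∀ k′ → k′ < k → ¬ R3Walk G I K k′) where

  shortcut : ∀ i j {l} → R3Walk G (at w i) (at w j) l → toℕ j ≤ l + toℕ i
  shortcut i j {l} c with m , s , j+m≡k ← suffix w j = +-cancelʳ-≤ m (toℕ j) (l + toℕ i) (begin
    toℕ j + m           ≡⟨ j+m≡k ⟩
    k                   ≤⟨ ≮⇒≥ (λ shorter → minimal _ shorter detour) ⟩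
    toℕ i + (l + m)     ≡⟨ +-assoc (toℕ i) l m ⟨
    toℕ i + l + m       ≡⟨ cong (_+ m) (+-comm (toℕ i) l) ⟩
    l + toℕ i + m       ∎)
    where
    open ≤-Reasoning
    detour : R3Walk G I K (toℕ i + (l + m))
    detour = prefix w (at-vertex w) i ++ʷ (c ++ʷ s)

  at-injective : ∀ {i j} → at w i ≡ at w j → i ≡ j
  at-injective {i} {j} eq =
    toℕ-injective (≤-antisym (shortcut j i (stay′ j i (sym eq))) (shortcut i j (stay′ i j eq)))
    where
    stay′ : ∀ a b → at w a ≡ at w b → R3Walk G (at w a) (at w b) 0
    stay′ a b eq = subst (λ J → R3Walk G (at w a) J 0) eq (stay (at-vertex w a))

  at-R3Adj⇔∼ : ∀ i j → R3Adj (at w i) (at w j) ⇔ toℕ i ∼ toℕ j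
  at-R3Adj⇔∼ i j =
    mk⇔ adjacent⇒∼ [ (λ i≡1+j → R3Adj-sym {p = at w j} (at-R3Adj w i≡1+j)) , at-R3Adj w ]
    where
    adjacent⇒∼ : R3Adj (at w i) (at w j) → toℕ i ∼ toℕ j
    adjacent⇒∼ i~j = ≢∧≤1+⇒∼
      (λ i≡j → R3Adj-irrefl {p = at w j} (proj₁ (at-vertex w j))
                 (subst (λ a → R3Adj (at w a) (at w j)) (toℕ-injective i≡j) i~j))
      (shortcut i j (step (at-vertex w i) i~j (stay (at-vertex w j))))
      (shortcut j i (step (at-vertex w j) (R3Adj-sym {p = at w i} i~j) (stay (at-vertex w i))))

module _ (G : Graph n) where

  independent? : (I : Subset n) → Dec (Independent G I)
  independent? I = all? λ x → all? λ y → x ∈? I →-dec y ∈? I →-dec adj G x y Bool.≟ false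

  R3Vertex? : (I : Subset n) → Dec (R3Vertex G I)
  R3Vertex? I = ∣ I ∣ ℕ.≟ 3 ×-dec independent? I

  R3Walk? : ∀ k I J → Dec (R3Walk G I J k)
  R3Walk? zero I J with ≡-dec Bool._≟_ I J | R3Vertex? I
  ... | yes refl | yes vI = yes (stay vI)
  ... | yes refl | no ¬vI = no λ { (stay vI) → ¬vI vI }
  ... | no I≢J | _ = no λ { (stay _) → I≢J refl }
  R3Walk? (suc k) I J =
    map′ (λ (_ , vI , I~L , w) → step vI I~L w) (λ { (step vI I~L w) → _ , vI , I~L , w })
      (anySubset? λ L → R3Vertex? I ×-dec ∣ I ∩ L ∣ ℕ.≟ 2 ×-dec R3Walk? k L J)

  R3Dist? : ∀ I J d → Dec (R3Dist G I J d)
  R3Dist? I J d = R3Walk? d I J ×-dec map′ (λ shorter k → shorter {k}) (λ shorter {k} → shorter k)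
    (allUpTo? (λ k → ¬? (R3Walk? k I J)) d)

module _ where
  open Inverse 2↔Bool using (to; from; strictlyInverseˡ)

  subsetToFin : Subset n → Fin (2 ^ n)
  subsetToFin p = funToFin (from ∘ lookup p)

  finToSubset : Fin (2 ^ n) → Subset n
  finToSubset c = tabulate (to ∘ finToFun c)

  finToSubset∘subsetToFin : ∀ (p : Subset n) → finToSubset (subsetToFin p) ≡ p
  finToSubset∘subsetToFin p = begin
    tabulate (to ∘ finToFun (subsetToFin p)) ≡⟨ tabulate-cong to∘finToFun≗lookup ⟩
    tabulate (lookup p)                      ≡⟨ tabulate∘lookup p ⟩
    p                                        ∎
    where
    open ≡-Reasoning
    to∘finToFun≗lookup : ∀ x → to (finToFun (subsetToFin p) x) ≡ lookup p x
    to∘finToFun≗lookup x = trans (cong to (finToFun-funToFin _ x)) (strictlyInverseˡ (lookup p x))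

  subsetToFin-injective : subsetToFin p ≡ subsetToFin q → p ≡ q
  subsetToFin-injective {p = p} {q} eq = begin
    p                            ≡⟨ finToSubset∘subsetToFin p ⟨
    finToSubset (subsetToFin p)  ≡⟨ cong finToSubset eq ⟩
    finToSubset (subsetToFin q)  ≡⟨ finToSubset∘subsetToFin q ⟩
    q                            ∎
    where open ≡-Reasoning

R3Dist⇒<2^n : ∀ {G : Graph n} {I J d} → R3Dist G I J d → d < 2 ^ n
R3Dist⇒<2^n (w , minimal) = ≰⇒> λ 2^n≤d →
  let i , j , i<j , same-code = pigeonhole (s≤s 2^n≤d) (subsetToFin ∘ at w)
  in Fin.<⇒≢ i<j (Geodesic.at-injective w minimal (subsetToFin-injective same-code))

bounded-maximum : {P : ℕ → Set} → (∀ d → Dec (P d)) → ∃ P → ∀ B → (∀ d → P d → d < B) →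
                  ∃[ D ] P D × (∀ d → P d → d ≤ D)
bounded-maximum P? (d , Pd) zero bound = contradiction (bound d Pd) λ ()
bounded-maximum P? ∃P (suc B) bound with P? B
... | yes PB = B , PB , λ d Pd → ≤-pred (bound d Pd)
... | no ¬PB = bounded-maximum P? ∃P B λ d Pd → ≤∧≢⇒< (≤-pred (bound d Pd)) λ { refl → ¬PB Pd }

∃-LargestCompDiam : (G : Graph n) → ∃[ I ] R3Vertex G I → ∃[ D ] LargestCompDiam G D
∃-LargestCompDiam {n} G (I , vI)
  with D , (I , J , IJ-dist) , maximal ← bounded-maximum
         (λ d → anySubset? λ I → anySubset? λ J → R3Dist? G I J d)
         (0 , I , I , stay vI , λ _ ())
         (2 ^ n) (λ d (_ , _ , IJ-dist) → R3Dist⇒<2^n IJ-dist)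
  = D , (I , J , IJ-dist) , λ I J d IJ-dist → maximal d (I , J , IJ-dist)

module ComplementGraph (R : Fin n → Fin n → Set) (R? : ∀ x y → Dec (R x y))
                       (R-refl : ∀ {x} → R x x) (R-sym : ∀ {x y} → R x y → R y x) where

  complementGraph : Graph n
  complementGraph = record
    { adj    = λ x y → not (does (R? x y))
    ; sym    = λ x y → cong not (does-⇔ (mk⇔ R-sym R-sym) (R? x y) (R? y x))
    ; irrefl = λ x → cong not (dec-true (R? x x) R-refl)
    }

  R⇒nonadjacent : R x y → adj complementGraph x y ≡ false
  R⇒nonadjacent {x} {y} r = cong not (dec-true (R? x y) r)

  ¬R⇒adjacent : ¬ R x y → adj complementGraph x y ≡ true
  ¬R⇒adjacent {x} {y} ¬r = cong not (dec-false (R? x y) ¬r)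

  nonadjacent⇒R : adj complementGraph x y ≡ false → R x y
  nonadjacent⇒R {x} {y} nonadjacent with R? x y | nonadjacent
  ... | yes r | _ = r
  ... | no _ | ()

module PathClosure {G : Graph n} {I K D} (w : R3Walk G I K D)
                   (minimal : ∀ k → k < D → ¬ R3Walk G I K k) where

  open Geodesic w minimal

  Covered : Fin n → Fin n → Set
  Covered x y = ∃[ i ] x ∈ at w i × y ∈ at w i

  NonEdge : Fin n → Fin n → Set
  NonEdge x y = x ≡ y ⊎ Covered x y

  nonEdge? : ∀ x y → Dec (NonEdge x y)
  nonEdge? x y = x ≟ y ⊎-dec any? λ i → x ∈? at w i ×-dec y ∈? at w i

  open ComplementGraph NonEdge nonEdge? (inj₁ refl)
    [ inj₁ ∘ sym , inj₂ ∘ Product.map₂ Product.swap ]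

  G′ : Graph n
  G′ = complementGraph

  G⊆EG′ : G ⊆E G′
  G⊆EG′ x y xy∈E = ¬R⇒adjacent {x} {y} λ
    { (inj₁ refl) → true≢false (trans (sym xy∈E) (irrefl G x))
    ; (inj₂ (i , x∈i , y∈i)) → true≢false (trans (sym xy∈E) (proj₂ (at-vertex w i) x y x∈i y∈i))
    }
    where
    true≢false : true ≢ false
    true≢false ()

  at-vertex′ : ∀ i → R3Vertex G′ (at w i)
  at-vertex′ i =
    proj₁ (at-vertex w i) , λ x y x∈i y∈i → R⇒nonadjacent {x} {y} (inj₂ (i , x∈i , y∈i))

  independent⇒covered : ∀ {T x y} → Independent G′ T → x ∈ T → y ∈ T → x ≢ y → Covered x y
  independent⇒covered {x = x} {y} T-independent x∈T y∈T x≢y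
    with nonadjacent⇒R {x} {y} (T-independent x y x∈T y∈T)
  ... | inj₁ x≡y = contradiction x≡y x≢y
  ... | inj₂ covered = covered

  R3Vertex-G′⇒G : ∀ {T} → R3Vertex G′ T → R3Vertex G T
  R3Vertex-G′⇒G (∣T∣≡3 , T-independent) = ∣T∣≡3 , independent
    where
    independent : Independent G _
    independent x y x∈T y∈T with x ≟ y
    ... | yes refl = irrefl G x
    ... | no x≢y with i , x∈i , y∈i ← independent⇒covered T-independent x∈T y∈T x≢y =
      proj₂ (at-vertex w i) x y x∈i y∈i

  private
    ∣at∣≡3 : ∀ i → ∣ at w i ∣ ≡ 3
    ∣at∣≡3 i = proj₁ (at-vertex w i)

  consecutive-triangle-impossible : ∀ i j k {x y z} →
    toℕ i ∼ toℕ j → toℕ j ∼ toℕ k → toℕ i ≢ toℕ k →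
    x ∈ at w i → x ∈ at w k → x ∉ at w j → y ∈ at w i → y ∈ at w j → y ∉ at w k →
    z ∈ at w j → z ∈ at w k → z ∉ at w i → ⊥
  consecutive-triangle-impossible i j k i∼j j∼k i≢k = chain-triangle-impossible
    (∣at∣≡3 i) (∣at∣≡3 j) (∣at∣≡3 k)
    (Equivalence.from (at-R3Adj⇔∼ i j) i∼j) (Equivalence.from (at-R3Adj⇔∼ j k) j∼k)
    (λ i~k → ∼-not-transitive i∼j j∼k (Equivalence.to (at-R3Adj⇔∼ i k) i~k))
    (λ fi≡fk → i≢k (cong toℕ (at-injective fi≡fk)))

  R3Adj-common-within-two : ∀ {T} i j → R3Vertex G T → R3Adj (at w i) T → R3Adj (at w j) T →
                            WithinTwo (toℕ i) (toℕ j)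
  R3Adj-common-within-two {T} i j vT i~T j~T = via j i j~T i~T , via i j i~T j~T
    where
    via : ∀ a b → R3Adj (at w a) T → R3Adj (at w b) T → toℕ b ≤ 2 + toℕ a
    via a b a~T b~T = shortcut a b
      (step (at-vertex w a) a~T (step vT (R3Adj-sym {p = at w b} b~T) (stay (at-vertex w b))))

  covered-triangle-on-path : ∀ {T a b c} → R3Vertex G T → a ∈ T → b ∈ T → c ∈ T →
    a ≢ b → a ≢ c → b ≢ c → Covered a b → Covered b c → Covered a c → ∃[ i ] at w i ≡ T
  covered-triangle-on-path {T} {a} {b} {c} vT@(∣T∣≡3 , _) a∈T b∈T c∈T a≢b a≢c b≢c
    (p , a∈p , b∈p) (q , b∈q , c∈q) (r , a∈r , c∈r)
    = on-path (c ∈? at w p) (a ∈? at w q) (b ∈? at w r)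
    where
    ∩⁺ : ∀ i {x} → x ∈ at w i → x ∈ T → x ∈ at w i ∩ T
    ∩⁺ _ x∈i x∈T = x∈p∩q⁺ (x∈i , x∈T)

    at≡T : ∀ i → a ∈ at w i → b ∈ at w i → c ∈ at w i → at w i ≡ T
    at≡T i a∈i b∈i c∈i = 3-sets-≡ (∣at∣≡3 i) ∣T∣≡3 (unique-length≤∣p∣
      ((a≢b ∷ a≢c ∷ []) ∷ (b≢c ∷ []) ∷ [] ∷ []) (∩⁺ i a∈i a∈T ∷ ∩⁺ i b∈i b∈T ∷ ∩⁺ i c∈i c∈T ∷ []))

    outer-triangle-impossible : c ∉ at w p → a ∉ at w q → b ∉ at w r → ⊥
    outer-triangle-impossible c∉p a∉q b∉r = middle-case (middle-of-three P≢Q Q≢R P≢R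
      (R3Adj-common-within-two p q vT p~T q~T) (R3Adj-common-within-two q r vT q~T r~T)
      (R3Adj-common-within-two p r vT p~T r~T))
      where
      R3Adj-at-T : ∀ i {x y z} → x ≢ y → x ∈ at w i → y ∈ at w i → x ∈ T → y ∈ T →
                   z ∉ at w i → z ∈ T → R3Adj (at w i) T
      R3Adj-at-T i x≢y x∈i y∈i x∈T y∈T z∉i z∈T = 3-sets-R3Adj (∣at∣≡3 i) ∣T∣≡3
        (unique-length≤∣p∣ ((x≢y ∷ []) ∷ [] ∷ []) (∩⁺ i x∈i x∈T ∷ ∩⁺ i y∈i y∈T ∷ []))
        (λ i≡T → z∉i (subst (_ ∈_) (sym i≡T) z∈T))

      p~T : R3Adj (at w p) T
      p~T = R3Adj-at-T p a≢b a∈p b∈p a∈T b∈T c∉p c∈T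
      q~T : R3Adj (at w q) T
      q~T = R3Adj-at-T q b≢c b∈q c∈q b∈T c∈T a∉q a∈T
      r~T : R3Adj (at w r) T
      r~T = R3Adj-at-T r a≢c a∈r c∈r a∈T c∈T b∉r b∈T

      separated : ∀ {i j x} → x ∈ at w i → x ∉ at w j → toℕ i ≢ toℕ j
      separated x∈i x∉j i≡j = x∉j (subst (λ k → _ ∈ at w k) (toℕ-injective i≡j) x∈i)

      P≢Q : toℕ p ≢ toℕ q
      P≢Q = ≢-sym (separated c∈q c∉p)
      Q≢R : toℕ q ≢ toℕ r
      Q≢R = ≢-sym (separated a∈r a∉q)
      P≢R : toℕ p ≢ toℕ r
      P≢R = separated b∈p b∉r

      middle-case : (toℕ p ∼ toℕ q × toℕ q ∼ toℕ r) ⊎ (toℕ q ∼ toℕ p × toℕ p ∼ toℕ r) ⊎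
                    (toℕ p ∼ toℕ r × toℕ r ∼ toℕ q) → ⊥
      middle-case (inj₁ (p∼q , q∼r)) = consecutive-triangle-impossible p q r p∼q q∼r P≢R
        a∈p a∈r a∉q b∈p b∈q b∉r c∈q c∈r c∉p
      middle-case (inj₂ (inj₁ (q∼p , p∼r))) = consecutive-triangle-impossible q p r q∼p p∼r Q≢R
        c∈q c∈r c∉p b∈q b∈p b∉r a∈p a∈r a∉q
      middle-case (inj₂ (inj₂ (p∼r , r∼q))) = consecutive-triangle-impossible p r q p∼r r∼q P≢Q
        b∈p b∈q b∉r a∈p a∈r a∉q c∈r c∈q c∉p

    on-path : Dec (c ∈ at w p) → Dec (a ∈ at w q) → Dec (b ∈ at w r) → ∃[ i ] at w i ≡ T
    on-path (yes c∈p) _ _ = p , at≡T p a∈p b∈p c∈p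
    on-path (no _) (yes a∈q) _ = q , at≡T q a∈q b∈q c∈q
    on-path (no _) (no _) (yes b∈r) = r , at≡T r a∈r b∈r c∈r
    on-path (no c∉p) (no a∉q) (no b∉r) = ⊥-elim (outer-triangle-impossible c∉p a∉q b∉r)

  at-surjective : ∀ T → R3Vertex G′ T → ∃[ i ] at w i ≡ T
  at-surjective T vT′@(∣T∣≡3 , T-independent) =
    let a , b , c , a∈T , b∈T , c∈T , a≢b , a≢c , b≢c = ∃-three-elements ∣T∣≡3
    in covered-triangle-on-path (R3Vertex-G′⇒G vT′) a∈T b∈T c∈T a≢b a≢c b≢c
         (covered a∈T b∈T a≢b) (covered b∈T c∈T b≢c) (covered a∈T c∈T a≢c)
    where
    covered : ∀ {x y} → x ∈ T → y ∈ T → x ≢ y → Covered x y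
    covered = independent⇒covered T-independent

  R3IsPath-G′ : R3IsPath G′
  R3IsPath-G′ = D , at w , at-vertex′ , (λ i j → at-injective) , at-surjective , at-R3Adj⇔∼

  segment-within-D : ∀ a b → toℕ a ≤ toℕ b → ∃[ l ] R3Walk G′ (at w a) (at w b) l × l ≤ D
  segment-within-D a b a≤b with l , c , a+l≡b ← segment w at-vertex′ a b a≤b =
    l , c , ≤-trans (m≤n+m l (toℕ a)) (subst (_≤ D) (sym a+l≡b) (toℕ≤pred[n] b))

  at-within-D : ∀ a b → ∃[ l ] R3Walk G′ (at w a) (at w b) l × l ≤ D
  at-within-D a b with ≤-total (toℕ a) (toℕ b)
  ... | inj₁ a≤b = segment-within-D a b a≤b
  ... | inj₂ b≤a with l , c , l≤D ← segment-within-D b a b≤a = l , reverse c , l≤D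

  at-dist≤D : ∀ a b {d} → R3Dist G′ (at w a) (at w b) d → d ≤ D
  at-dist≤D a b ab-dist = via (at-within-D a b)
    where
    via : (∃[ l ] R3Walk G′ (at w a) (at w b) l × l ≤ D) → _ ≤ D
    via (l , c , l≤D) = ≤-trans (R3Dist-minimal ab-dist c) l≤D

  LargestCompDiam-G′ : LargestCompDiam G′ D
  LargestCompDiam-G′ = (I , at w (fromℕ D) , end-to-end , end-to-end-minimal) , bounded
    where
    end-to-end : R3Walk G′ I (at w (fromℕ D)) D
    end-to-end = subst (R3Walk G′ I (at w (fromℕ D))) (toℕ-fromℕ D) (prefix w at-vertex′ (fromℕ D))

    end-to-end-minimal : ∀ k → k < D → ¬ R3Walk G′ I (at w (fromℕ D)) k
    end-to-end-minimal k k<D c = <⇒≱ k<D (subst₂ _≤_ (toℕ-fromℕ D) (+-identityʳ k)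
        (shortcut zero (fromℕ D) (map-R3Walk R3Vertex-G′⇒G c)))

    bounded : ∀ T U d → R3Dist G′ T U d → d ≤ D
    bounded T U d TU-dist@(c , _) =
      via (at-surjective T (source-vertex c)) (at-surjective U (target-vertex c))
      where
      via : ∃[ a ] at w a ≡ T → ∃[ b ] at w b ≡ U → d ≤ D
      via (a , a≡T) (b , b≡U) =
        at-dist≤D a b (subst₂ (λ X Y → R3Dist G′ X Y d) (sym a≡T) (sym b≡U) TU-dist)

mainTheorem11 : ∀ (n : ℕ) (G : Graph n) → (∃[ I ] R3Vertex G I) →
    ∃[ G' ] (G ⊆E G' × R3IsPath G' ×
      ∃[ D ] (LargestCompDiam G D × LargestCompDiam G' D))
mainTheorem11 n G ∃vertex =
  let D , diameter@((_ , _ , w , minimal) , _) = ∃-LargestCompDiam G ∃vertex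
      open PathClosure w minimal
  in G′ , G⊆EG′ , R3IsPath-G′ , D , diameter , LargestCompDiam-G′
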